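{- Let $K$ and $K_1$ be kind assignments, $\tau$ a monotype and $k$ a kind. If $K\Vdash\tau::k$ and the kinded substitution $(K_1,S)$ respects $K$, then $K_1\Vdash S(\tau)::S(k)$.
   Context: Types. Fix type variables $\alpha,\dots$, labels $l,\dots$ and finitely many base types $b$. $\tau ::= b\mid\rho\mid\tau\to\tau$; extensible types $\rho ::= \alpha\mid\{l_1:\tau_1,\dots,l_n:\tau_n\}\mid\rho+\{l:\tau\}\mid\rho-\{l:\tau\}$ (record types, type extensions, type contractions); kinds $k ::= \mathcal{U}\mid\{\!\{l_1:\tau_1,\dots,l_n:\tau_n\,\|\,l'_1:\tau'_1,\dots,l'_m:\tau'_m\}\!\}$ (universal kind; record kind whose left fields must be present and right fields absent). Labels within a record type or kind are pairwise distinct and unordered. A kind assignment $K$ is a finite map from type variables to kinds with $\mathrm{FTV}(K(\alpha))\subseteq\mathrm{dom}K$ for $\alpha\in\mathrm{dom}K$; an object is well formed under $K$ if its free type variables lie in $\mathrm{dom}K$. Kinding. $K\Vdash\tau::k$ iff derivable by: (i) $K\Vdash\tau::\mathcal{U}$ for $\tau$ well formed under $K$; (ii) $K\Vdash\{l_1:\tau_1,\dots,l_n:\tau_n,\dots\}::\{\!\{l_1:\tau_1,\dots,l_n:\tau_n\,\|\,l'_1:\tau'_1,\dots,l'_m:\tau'_m\}\!\}$ if $\{l_1,\dots,l_n,\dots\}\cap\{l'_1,\dots,l'_m\}=\emptyset$ and the record type and the $\tau'_i$ are well formed under $K$; (iii) $K\Vdash\alpha::\{\!\{F^l\|F^r\}\!\}$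 if $K(\alpha)=\{\!\{F^l,\dots\|F^r,\dots\}\!\}$; (iv) $K\Vdash\rho+\{l:\tau\}::\{\!\{F^l,[l:\tau]\|F^r\}\!\}$ if $K\Vdash\rho::\{\!\{F^l\|F^r,l:\tau\}\!\}$; (v) $K\Vdash\rho-\{l:\tau\}::\{\!\{F^l\|F^r,[l:\tau]\}\!\}$ if $K\Vdash\rho::\{\!\{F^l,l:\tau\|F^r\}\!\}$; $[l:\tau]$ denotes optional inclusion. Substitutions. A substitution $S$ maps finitely many type variables to types, $S(\alpha)=\alpha$ elsewhere, extended homomorphically: $S(\{l_i:\tau_i\}_i)=\{l_i:S(\tau_i)\}_i$, $S(\tau_1\to\tau_2)=S(\tau_1)\to S(\tau_2)$, $S(\rho\pm\{l:\tau\})=S(\rho)\pm\{l:S(\tau)\}$, and fieldwise on kinds ($S(\mathcal{U})=\mathcal{U}$). $S$ is well formed under $K$ if each $S(\alpha)$, $\alpha\in\mathrm{dom}S$, is. A kinded substitution is $(K,S)$ with $S$ well formed under $K$; $(K_1,S)$ respects $K_2$ if $K_1\Vdash S(\alpha)::S(K_2(\alpha))$ for all $\alpha\in\mathrm{dom}K_2$. -}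

module Defs where

open import Data.Nat using (ℕ; _≟_)
open import Data.Fin using (Fin)
open import Data.Unit using (⊤)
open import Data.List using (List; []; _∷_; _++_; map)
open import Data.List.Membership.Propositional using (_∈_)
open import Data.List.Relation.Unary.All using (All)
open import Data.List.Relation.Unary.Unique.Propositional using (Unique)
open import Data.List.Relation.Binary.Permutation.Propositional using (_↭_)
open import Data.List.Relation.Binary.Subset.Propositional using (_⊆_)
open import Data.List.Relation.Binary.Disjoint.Propositional using (Disjoint)
open import Data.Product using (_×_; _,_; proj₁; proj₂)
open import Data.Sum using (_⊎_)
open import Relation.Nullary using (yes; no)

TyVar : Set
TyVar = ℕ

Label : Set
Label = ℕ

data Ty (nb : ℕ) : Set where
  base : Fin nb → Ty nb
  tvar : TyVar → Ty nb
  _⇒_  : Ty nb → Ty nb → Ty nb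
  recd : List (Label × Ty nb) → Ty nb
  _⊕_  : Ty nb → Label × Ty nb → Ty nb
  _⊖_  : Ty nb → Label × Ty nb → Ty nb

Fields : ℕ → Set
Fields nb = List (Label × Ty nb)

-- Kinds: U is the universal kind, recK Fl Fr is {{ Fl ‖ Fr }}.
data Kind (nb : ℕ) : Set where
  U    : Kind nb
  recK : Fields nb → Fields nb → Kind nb

labels : ∀ {nb} → Fields nb → List Label
labels = map proj₁

mutual
  ValidTy : ∀ {nb} → Ty nb → Set
  ValidTy (base b)      = ⊤
  ValidTy (tvar α)      = ⊤
  ValidTy (σ ⇒ τ)       = ValidTy σ × ValidTy τ
  ValidTy (recd F)      = ValidFields F
  ValidTy (ρ ⊕ (l , τ)) = ValidTy ρ × ValidTy τ
  ValidTy (ρ ⊖ (l , τ)) = ValidTy ρ × ValidTy τ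

  AllValid : ∀ {nb} → Fields nb → Set
  AllValid []            = ⊤
  AllValid ((l , τ) ∷ F) = ValidTy τ × AllValid F

  ValidFields : ∀ {nb} → Fields nb → Set
  ValidFields F = Unique (labels F) × AllValid F

ValidKind : ∀ {nb} → Kind nb → Set
ValidKind U            = ⊤
ValidKind (recK Fl Fr) = ValidFields Fl × ValidFields Fr

mutual
  ftv : ∀ {nb} → Ty nb → List TyVar
  ftv (base b)      = []
  ftv (tvar α)      = α ∷ []
  ftv (σ ⇒ τ)       = ftv σ ++ ftv τ
  ftv (recd F)      = ftvF F
  ftv (ρ ⊕ (l , τ)) = ftv ρ ++ ftv τ
  ftv (ρ ⊖ (l , τ)) = ftv ρ ++ ftv τ

  ftvF : ∀ {nb} → Fields nb → List TyVar
  ftvF []            = []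
  ftvF ((l , τ) ∷ F) = ftv τ ++ ftvF F

ftvK : ∀ {nb} → Kind nb → List TyVar
ftvK U            = []
ftvK (recK Fl Fr) = ftvF Fl ++ ftvF Fr

-- Kind assignments: finite maps from type variables to kinds,
-- represented as association lists with pairwise distinct keys.

KindAssign : ℕ → Set
KindAssign nb = List (TyVar × Kind nb)

dom : ∀ {A : Set} → List (TyVar × A) → List TyVar
dom = map proj₁

WFTy : ∀ {nb} → KindAssign nb → Ty nb → Set
WFTy K τ = ftv τ ⊆ dom K

WFKind : ∀ {nb} → KindAssign nb → Kind nb → Set
WFKind K k = ftvK k ⊆ dom K

IsKindAssign : ∀ {nb} → KindAssign nb → Set
IsKindAssign K =
  Unique (dom K) ×
  (∀ {α k} → (α , k) ∈ K → ValidKind k × WFKind K k)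

-- Kinding  K ⊩ τ ∷ k.  Record types and kinds are unordered: field
-- inclusion is list-membership inclusion, and the extra field in rules
-- (iv),(v) may sit anywhere (up to permutation ↭).

data _⊩_∷_ {nb : ℕ} (K : KindAssign nb) : Ty nb → Kind nb → Set where
  k-U   : ∀ {τ} → ValidTy τ → WFTy K τ → K ⊩ τ ∷ U
  k-rec : ∀ {F Fl Fr} →
          ValidTy (recd F) → WFTy K (recd F) →
          All (λ p → WFTy K (proj₂ p)) Fr →
          Fl ⊆ F → Disjoint (labels F) (labels Fr) →
          ValidKind (recK Fl Fr) →
          K ⊩ recd F ∷ recK Fl Fr
  k-var : ∀ {α Gl Gr Fl Fr} →
          (α , recK Gl Gr) ∈ K → Fl ⊆ Gl → Fr ⊆ Gr →
          ValidKind (recK Fl Fr) →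
          K ⊩ tvar α ∷ recK Fl Fr
  k-ext : ∀ {ρ l τ Fl Fl′ Fr Fr′} →
          K ⊩ ρ ∷ recK Fl Fr′ → Fr′ ↭ ((l , τ) ∷ Fr) →
          (Fl′ ↭ Fl ⊎ Fl′ ↭ ((l , τ) ∷ Fl)) →
          ValidKind (recK Fl′ Fr) →
          K ⊩ ρ ⊕ (l , τ) ∷ recK Fl′ Fr
  k-con : ∀ {ρ l τ Fl Fl′ Fr Fr′} →
          K ⊩ ρ ∷ recK Fl′ Fr → Fl′ ↭ ((l , τ) ∷ Fl) →
          (Fr′ ↭ Fr ⊎ Fr′ ↭ ((l , τ) ∷ Fr)) →
          ValidKind (recK Fl Fr′) →
          K ⊩ ρ ⊖ (l , τ) ∷ recK Fl Fr′

-- Substitutions: finite maps from type variables to types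
-- (association lists with distinct keys), identity elsewhere.

Subst : ℕ → Set
Subst nb = List (TyVar × Ty nb)

substVar : ∀ {nb} → Subst nb → TyVar → Ty nb
substVar [] α = tvar α
substVar ((β , σ) ∷ S) α with α ≟ β
... | yes _ = σ
... | no  _ = substVar S α

mutual
  substTy : ∀ {nb} → Subst nb → Ty nb → Ty nb
  substTy S (base b)      = base b
  substTy S (tvar α)      = substVar S α
  substTy S (σ ⇒ τ)       = substTy S σ ⇒ substTy S τ
  substTy S (recd F)      = recd (substF S F)
  substTy S (ρ ⊕ (l , τ)) = substTy S ρ ⊕ (l , substTy S τ)
  substTy S (ρ ⊖ (l , τ)) = substTy S ρ ⊖ (l , substTy S τ)

  substF : ∀ {nb} → Subst nb → Fields nb → Fields nb
  substF S []            = []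
  substF S ((l , τ) ∷ F) = (l , substTy S τ) ∷ substF S F

substK : ∀ {nb} → Subst nb → Kind nb → Kind nb
substK S U            = U
substK S (recK Fl Fr) = recK (substF S Fl) (substF S Fr)

IsSubst : ∀ {nb} → Subst nb → Set
IsSubst S = Unique (dom S) × (∀ {α σ} → (α , σ) ∈ S → ValidTy σ)

SubstWF : ∀ {nb} → KindAssign nb → Subst nb → Set
SubstWF K S = ∀ {α σ} → (α , σ) ∈ S → WFTy K σ

KindedSubst : ∀ {nb} → KindAssign nb → Subst nb → Set
KindedSubst K₁ S = IsSubst S × SubstWF K₁ S

Respects : ∀ {nb} → KindAssign nb → Subst nb → KindAssign nb → Set
Respects K₁ S K₂ =
  ∀ {α k} → (α , k) ∈ K₂ → K₁ ⊩ substTy S (tvar α) ∷ substK S k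

module Submission where

-- A substitution acts fieldwise and leaves labels
-- alone, so it preserves validity, inclusions and permutations of field lists, and
-- well-formedness (a variable α of K fixed by S lies in K₁, since respecting K kinds
-- S(α) = α under K₁); hence rules (i), (ii), (iv) and (v) are mapped to themselves. For
-- rule (iii), respecting K gives S(α) the kind S(K(α)), which may have more fields than
-- required; so the real work is that a derivable record kind can be weakened to any valid
-- record kind with fewer fields, by a separate induction on derivations.

open import Defs
open import Data.Nat as ℕ using (ℕ)
open import Data.Unit using (tt)
open import Data.Empty using (⊥-elim)
open import Function using (_∘_)
open import Data.List using (List; []; _∷_; _++_; map)
open import Data.List.Relation.Unary.All as All using (All; []; _∷_)
open import Data.List.Relation.Unary.Any using (here; there)
open import Data.List.Relation.Unary.AllPairs using (_∷_)
open import Data.List.Relation.Unary.Unique.Propositional using (Unique)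
open import Data.List.Relation.Unary.Unique.Propositional.Properties using (Unique[x∷xs]⇒x∉xs)
open import Data.List.Membership.Propositional using (_∈_; _∉_)
open import Data.List.Membership.Propositional.Properties using (∈-map⁺; ∈-map⁻; ∈-++⁺ˡ; ∈-++⁺ʳ; ∈-++⁻; ∈-∃++)
open import Data.List.Membership.DecPropositional ℕ._≟_ using (_∈?_)
open import Data.List.Relation.Binary.Subset.Propositional using (_⊆_)
open import Data.List.Relation.Binary.Subset.Propositional.Properties as ⊆
  using (⊆-trans; ⊆-respʳ-↭; All-resp-⊇; xs⊆x∷xs; ∷⁺ʳ; ⊆∷∧∉⇒⊆)
open import Data.List.Relation.Binary.Disjoint.Propositional using (Disjoint)
open import Data.List.Relation.Binary.Permutation.Propositional using (_↭_; ↭-refl; ↭-sym; ↭⇒↭ₛ)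
open import Data.List.Relation.Binary.Permutation.Propositional.Properties as ↭ using (shift)
import Data.List.Relation.Binary.Permutation.Setoid.Properties as ↭ₛ
open import Data.Product using (∃; _×_; _,_; -,_; proj₁; proj₂)
open import Data.Sum as Sum using (_⊎_; inj₁; inj₂; [_,_]′)
open import Relation.Binary.PropositionalEquality using (_≡_; _≢_; refl; sym; cong; subst; subst₂; setoid)
open import Relation.Nullary using (yes; no)

module _ {A : Set} where

  Unique-resp-↭ : ∀ {xs ys : List A} → xs ↭ ys → Unique xs → Unique ys
  Unique-resp-↭ p = ↭ₛ.Unique-resp-↭ (setoid A) (↭⇒↭ₛ p)

  ++-⊆ : ∀ {xs ys zs : List A} → xs ⊆ zs → ys ⊆ zs → xs ++ ys ⊆ zs
  ++-⊆ {xs} xs⊆zs ys⊆zs = [ xs⊆zs , ys⊆zs ]′ ∘ ∈-++⁻ xs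

  Unique-map-injective : ∀ {B : Set} (f : A → B) {xs x y} → Unique (map f xs) →
                         x ∈ xs → y ∈ xs → f x ≡ f y → x ≡ y
  Unique-map-injective f _ (here refl) (here refl) _ = refl
  Unique-map-injective f (fx∉ ∷ _) (here refl) (there y∈) fx≡fy =
    ⊥-elim (All.lookup fx∉ (∈-map⁺ f y∈) fx≡fy)
  Unique-map-injective f (fy∉ ∷ _) (there x∈) (here refl) fx≡fy =
    ⊥-elim (All.lookup fy∉ (∈-map⁺ f x∈) (sym fx≡fy))
  Unique-map-injective f (_ ∷ u) (there x∈) (there y∈) fx≡fy =
    Unique-map-injective f u x∈ y∈ fx≡fy

module _ {nb : ℕ} where

  -- The paper's optional inclusion [l : τ], up to permutation, as in rules (iv) and (v).
  _↭[_]?_ : Fields nb → Label × Ty nb → Fields nb → Set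
  F ↭[ x ]? G = F ↭ G ⊎ F ↭ x ∷ G

  AllValid⇒All : ∀ {F : Fields nb} → AllValid F → All (ValidTy ∘ proj₂) F
  AllValid⇒All {[]} _ = []
  AllValid⇒All {_ ∷ _} (v , vs) = v ∷ AllValid⇒All vs

  All⇒AllValid : ∀ {F : Fields nb} → All (ValidTy ∘ proj₂) F → AllValid F
  All⇒AllValid [] = tt
  All⇒AllValid (v ∷ vs) = v , All⇒AllValid vs

  ValidFields-⊆ : ∀ {F G : Fields nb} → Unique (labels F) → F ⊆ G → ValidFields G → ValidFields F
  ValidFields-⊆ uF F⊆G (_ , vG) = uF , All⇒AllValid (All-resp-⊇ F⊆G (AllValid⇒All vG))

  ∈⇒↭∷ : ∀ {x : Label × Ty nb} {F} → x ∈ F → ValidFields F →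
         ∃ λ F₀ → F ↭ x ∷ F₀ × F₀ ⊆ F × x ∉ F₀ × ValidFields F₀
  ∈⇒↭∷ {x} x∈F vF@(uF , _) with ys , zs , refl ← ∈-∃++ x∈F =
    ys ++ zs , F↭xF₀ , F₀⊆F , l∉F₀ ∘ ∈-map⁺ proj₁ , ValidFields-⊆ uF₀ F₀⊆F vF
    where
    F↭xF₀ : ys ++ x ∷ zs ↭ x ∷ ys ++ zs
    F↭xF₀ = shift x ys zs
    F₀⊆F : ys ++ zs ⊆ ys ++ x ∷ zs
    F₀⊆F = ⊆-respʳ-↭ (↭-sym F↭xF₀) (xs⊆x∷xs (ys ++ zs) x)
    u : Unique (labels (x ∷ ys ++ zs))
    u = Unique-resp-↭ (↭.map⁺ proj₁ F↭xF₀) uF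
    l∉F₀ : proj₁ x ∉ labels (ys ++ zs)
    l∉F₀ = Unique[x∷xs]⇒x∉xs u
    uF₀ : Unique (labels (ys ++ zs))
    uF₀ with _ ∷ uF₀ ← u = uF₀

  ⊆∷⇒↭[]? : ∀ {x : Label × Ty nb} {F G} → Unique (labels (x ∷ G)) → ValidFields F →
            F ⊆ x ∷ G → ∃ λ F₀ → F ↭[ x ]? F₀ × F₀ ⊆ G × ValidFields F₀
  ⊆∷⇒↭[]? {x} {F} uxG vF F⊆xG with proj₁ x ∈? labels F
  ... | no l∉F = F , inj₁ ↭-refl , ⊆∷∧∉⇒⊆ F⊆xG (l∉F ∘ ∈-map⁺ proj₁) , vF
  ... | yes l∈F
    with y , y∈F , l≡ ← ∈-map⁻ proj₁ l∈F
    with refl ← Unique-map-injective proj₁ uxG (F⊆xG y∈F) (here refl) (sym l≡)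
    with F₀ , F↭xF₀ , F₀⊆F , x∉F₀ , vF₀ ← ∈⇒↭∷ y∈F vF
    = F₀ , inj₂ F↭xF₀ , ⊆∷∧∉⇒⊆ (⊆-trans F₀⊆F F⊆xG) x∉F₀ , vF₀

  ⊆-↭[]? : ∀ {x : Label × Ty nb} {F G G₀} → Unique (labels G) → ValidFields F →
           F ⊆ G → G ↭[ x ]? G₀ → ∃ λ F₀ → F ↭[ x ]? F₀ × F₀ ⊆ G₀ × ValidFields F₀
  ⊆-↭[]? _ vF F⊆G (inj₁ G↭G₀) = -, inj₁ ↭-refl , ⊆-respʳ-↭ G↭G₀ F⊆G , vF
  ⊆-↭[]? uG vF F⊆G (inj₂ G↭xG₀) =
    ⊆∷⇒↭[]? (Unique-resp-↭ (↭.map⁺ proj₁ G↭xG₀) uG) vF (⊆-respʳ-↭ G↭xG₀ F⊆G)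

  ∷-⊆-↭ : ∀ {x : Label × Ty nb} {F G G′} → ValidFields G′ → G′ ↭ x ∷ G →
          F ⊆ G → Unique (labels F) → x ∷ F ⊆ G′ × ValidFields (x ∷ F)
  ∷-⊆-↭ {x} {F} {G′ = G′} vG′@(uG′ , _) G′↭xG F⊆G uF = xF⊆G′ , ValidFields-⊆ (l∉F ∷ uF) xF⊆G′ vG′
    where
    xF⊆G′ : x ∷ F ⊆ G′
    xF⊆G′ = ⊆-respʳ-↭ (↭-sym G′↭xG) (∷⁺ʳ x F⊆G)
    l∉F : All (proj₁ x ≢_) (labels F)
    l∉F with l∉G ∷ _ ← Unique-resp-↭ (↭.map⁺ proj₁ G′↭xG) uG′ =
      All-resp-⊇ (⊆.map⁺ proj₁ F⊆G) l∉G

  ⊩-validKind : ∀ {K : KindAssign nb} {τ k} → K ⊩ τ ∷ k → ValidKind k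
  ⊩-validKind (k-U _ _) = tt
  ⊩-validKind (k-rec _ _ _ _ _ vk) = vk
  ⊩-validKind (k-var _ _ _ vk) = vk
  ⊩-validKind (k-ext _ _ _ vk) = vk
  ⊩-validKind (k-con _ _ _ vk) = vk

  ⊩-weaken : ∀ {K : KindAssign nb} {τ Gl Gr Fl Fr} → K ⊩ τ ∷ recK Gl Gr →
             Fl ⊆ Gl → Fr ⊆ Gr → ValidKind (recK Fl Fr) → K ⊩ τ ∷ recK Fl Fr
  ⊩-weaken (k-rec v w wGr Gl⊆F dis _) Fl⊆Gl Fr⊆Gr vk =
    k-rec v w (All-resp-⊇ Fr⊆Gr wGr) (⊆-trans Fl⊆Gl Gl⊆F)
          (λ (l∈F , l∈Fr) → dis (l∈F , ⊆.map⁺ proj₁ Fr⊆Gr l∈Fr)) vk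
  ⊩-weaken (k-var α∈K Gl⊆ Gr⊆ _) Fl⊆Gl Fr⊆Gr vk =
    k-var α∈K (⊆-trans Fl⊆Gl Gl⊆) (⊆-trans Fr⊆Gr Gr⊆) vk
  ⊩-weaken (k-ext d Gr′↭ Gl↭ ((uGl , _) , _)) Fl⊆Gl Fr⊆Gr vk@(vFl , (uFr , _))
    with Fl₀ , Fl↭ , Fl₀⊆ , vFl₀ ← ⊆-↭[]? uGl vFl Fl⊆Gl Gl↭
    with xFr⊆ , vxFr ← ∷-⊆-↭ (proj₂ (⊩-validKind d)) Gr′↭ Fr⊆Gr uFr
    = k-ext (⊩-weaken d Fl₀⊆ xFr⊆ (vFl₀ , vxFr)) ↭-refl Fl↭ vk
  ⊩-weaken (k-con d Gl′↭ Gr↭ (_ , (uGr , _))) Fl⊆Gl Fr⊆Gr vk@((uFl , _) , vFr)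
    with Fr₀ , Fr↭ , Fr₀⊆ , vFr₀ ← ⊆-↭[]? uGr vFr Fr⊆Gr Gr↭
    with xFl⊆ , vxFl ← ∷-⊆-↭ (proj₁ (⊩-validKind d)) Gl′↭ Fl⊆Gl uFl
    = k-con (⊩-weaken d xFl⊆ Fr₀⊆ (vxFl , vFr₀)) ↭-refl Fr↭ vk

  ⊩-tvar⇒wf : ∀ {K : KindAssign nb} {α k} → K ⊩ tvar α ∷ k → WFTy K (tvar α)
  ⊩-tvar⇒wf (k-U _ w) = w
  ⊩-tvar⇒wf (k-var αk∈K _ _ _) (here refl) = ∈-map⁺ proj₁ αk∈K

substVar≡tvar⊎∈ : ∀ {nb} (S : Subst nb) α → substVar S α ≡ tvar α ⊎ (α , substVar S α) ∈ S
substVar≡tvar⊎∈ [] α = inj₁ refl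
substVar≡tvar⊎∈ ((β , σ) ∷ S) α with α ℕ.≟ β
... | yes refl = inj₂ (here refl)
... | no _ = Sum.map₂ there (substVar≡tvar⊎∈ S α)

module _ {nb : ℕ} (S : Subst nb) where

  substField : Label × Ty nb → Label × Ty nb
  substField (l , τ) = l , substTy S τ

  substF≡map : ∀ F → substF S F ≡ map substField F
  substF≡map [] = refl
  substF≡map (_ ∷ F) = cong (_ ∷_) (substF≡map F)

  labels-substF : ∀ F → labels (substF S F) ≡ labels F
  labels-substF [] = refl
  labels-substF ((l , _) ∷ F) = cong (l ∷_) (labels-substF F)

  substF-⊆ : ∀ {F G} → F ⊆ G → substF S F ⊆ substF S G
  substF-⊆ {F} {G} F⊆G rewrite substF≡map F | substF≡map G = ⊆.map⁺ substField F⊆G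

  substF-↭ : ∀ {F G} → F ↭ G → substF S F ↭ substF S G
  substF-↭ {F} {G} F↭G rewrite substF≡map F | substF≡map G = ↭.map⁺ substField F↭G

  substF-↭[]? : ∀ {x F G} → F ↭[ x ]? G → substF S F ↭[ substField x ]? substF S G
  substF-↭[]? = Sum.map substF-↭ substF-↭

  module _ {D : List TyVar} where
    mutual
      ftv-substTy : ∀ τ → (∀ {α} → α ∈ ftv τ → ftv (substVar S α) ⊆ D) → ftv (substTy S τ) ⊆ D
      ftv-substTy (base b) h ()
      ftv-substTy (tvar α) h = h (here refl)
      ftv-substTy (σ ⇒ τ) h = ftv-subst₂ σ τ h
      ftv-substTy (recd F) h = ftv-substF F h
      ftv-substTy (ρ ⊕ (l , τ)) h = ftv-subst₂ ρ τ h
      ftv-substTy (ρ ⊖ (l , τ)) h = ftv-subst₂ ρ τ h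

      ftv-subst₂ : ∀ σ τ → (∀ {α} → α ∈ ftv σ ++ ftv τ → ftv (substVar S α) ⊆ D) →
                   ftv (substTy S σ) ++ ftv (substTy S τ) ⊆ D
      ftv-subst₂ σ τ h =
        ++-⊆ (ftv-substTy σ (λ α∈ → h (∈-++⁺ˡ α∈))) (ftv-substTy τ (λ α∈ → h (∈-++⁺ʳ (ftv σ) α∈)))

      ftv-substF : ∀ F → (∀ {α} → α ∈ ftvF F → ftv (substVar S α) ⊆ D) → ftvF (substF S F) ⊆ D
      ftv-substF [] h ()
      ftv-substF ((l , τ) ∷ F) h =
        ++-⊆ (ftv-substTy τ (λ α∈ → h (∈-++⁺ˡ α∈))) (ftv-substF F (λ α∈ → h (∈-++⁺ʳ (ftv τ) α∈)))

  module Validity (S-valid : ∀ {α σ} → (α , σ) ∈ S → ValidTy σ) where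

    substVar-valid : ∀ α → ValidTy (substVar S α)
    substVar-valid α with substVar≡tvar⊎∈ S α
    ... | inj₁ eq = subst ValidTy (sym eq) tt
    ... | inj₂ α↦ = S-valid α↦

    mutual
      substTy-valid : ∀ τ → ValidTy τ → ValidTy (substTy S τ)
      substTy-valid (base b) _ = tt
      substTy-valid (tvar α) _ = substVar-valid α
      substTy-valid (σ ⇒ τ) (vσ , vτ) = substTy-valid σ vσ , substTy-valid τ vτ
      substTy-valid (recd F) vF = substF-valid F vF
      substTy-valid (ρ ⊕ (l , τ)) (vρ , vτ) = substTy-valid ρ vρ , substTy-valid τ vτ
      substTy-valid (ρ ⊖ (l , τ)) (vρ , vτ) = substTy-valid ρ vρ , substTy-valid τ vτ

      substF-allValid : ∀ F → AllValid F → AllValid (substF S F)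
      substF-allValid [] _ = tt
      substF-allValid ((l , τ) ∷ F) (vτ , vF) = substTy-valid τ vτ , substF-allValid F vF

      substF-valid : ∀ F → ValidFields F → ValidFields (substF S F)
      substF-valid F (uF , vF) = subst Unique (sym (labels-substF F)) uF , substF-allValid F vF

    substK-valid : ∀ k → ValidKind k → ValidKind (substK S k)
    substK-valid U _ = tt
    substK-valid (recK Fl Fr) (vFl , vFr) = substF-valid Fl vFl , substF-valid Fr vFr

module _ {nb : ℕ} {K K₁ : KindAssign nb} {S : Subst nb}
         (kS : KindedSubst K₁ S) (resp : Respects K₁ S K) where

  open Validity S (proj₂ (proj₁ kS))

  substVar-wf : ∀ {α} → α ∈ dom K → WFTy K₁ (substVar S α)
  substVar-wf {α} α∈K with substVar≡tvar⊎∈ S α | ∈-map⁻ proj₁ α∈K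
  ... | inj₂ α↦ | _ = proj₂ kS α↦
  ... | inj₁ eq | (_ , k) , αk∈K , refl =
    subst (WFTy K₁) (sym eq) (⊩-tvar⇒wf (subst (λ σ → K₁ ⊩ σ ∷ substK S k) eq (resp αk∈K)))

  substTy-wf : ∀ τ → WFTy K τ → WFTy K₁ (substTy S τ)
  substTy-wf τ wτ = ftv-substTy S τ (λ α∈ → substVar-wf (wτ α∈))

  substF-wf : ∀ {F : Fields nb} → All (WFTy K ∘ proj₂) F → All (WFTy K₁ ∘ proj₂) (substF S F)
  substF-wf [] = []
  substF-wf {(_ , τ) ∷ _} (wτ ∷ wF) = substTy-wf τ wτ ∷ substF-wf wF

  ⊩-subst : ∀ {τ k} → K ⊩ τ ∷ k → K₁ ⊩ substTy S τ ∷ substK S k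
  ⊩-subst (k-U {τ} vτ wτ) = k-U (substTy-valid τ vτ) (substTy-wf τ wτ)
  ⊩-subst (k-rec {F} {Fl} {Fr} vF wF wFr Fl⊆F dis vk) =
    k-rec (substF-valid F vF) (substTy-wf (recd F) wF) (substF-wf wFr) (substF-⊆ S Fl⊆F)
          (subst₂ Disjoint (sym (labels-substF S F)) (sym (labels-substF S Fr)) dis)
          (substK-valid (recK Fl Fr) vk)
  ⊩-subst (k-var {Fl = Fl} {Fr} αk∈K Fl⊆ Fr⊆ vk) =
    ⊩-weaken (resp αk∈K) (substF-⊆ S Fl⊆) (substF-⊆ S Fr⊆) (substK-valid (recK Fl Fr) vk)
  ⊩-subst (k-ext {Fl′ = Fl′} {Fr} d Fr′↭ Fl′↭ vk) =
    k-ext (⊩-subst d) (substF-↭ S Fr′↭) (substF-↭[]? S Fl′↭) (substK-valid (recK Fl′ Fr) vk)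
  ⊩-subst (k-con {Fl = Fl} {Fr′ = Fr′} d Fl′↭ Fr′↭ vk) =
    k-con (⊩-subst d) (substF-↭ S Fl′↭) (substF-↭[]? S Fr′↭) (substK-valid (recK Fl Fr′) vk)

mainTheorem10 : ∀ {nb} (K K₁ : KindAssign nb) (S : Subst nb) (τ : Ty nb) (k : Kind nb) →
    IsKindAssign K → IsKindAssign K₁ → KindedSubst K₁ S →
    K ⊩ τ ∷ k → Respects K₁ S K →
    K₁ ⊩ substTy S τ ∷ substK S k
mainTheorem10 K K₁ S τ k _ _ kS d resp = ⊩-subst kS resp d
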